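{- Let $n \geq 3$, $m_i \geq 3$ for all $1 \leq i \leq n$, and $G = K_{m_1} \square \cdots \square K_{m_n}$. Then \[ \gamma^{\mathrm{GID}}(G) \geq \frac{3\, m_1 m_2 \cdots m_n}{\sum_{i=1}^n m_i - n + 3}. \]
   Context: $G$ is the Hamming graph with vertex set $\mathbb{Z}_{m_1} \times \cdots \times \mathbb{Z}_{m_n}$, a group under componentwise modular addition, two vertices adjacent iff they differ in exactly one coordinate. For $C \subseteq V(G)$, $J_C(v) = N[v] \cap C$ with $N[v]$ the closed neighborhood. $C$ is an identifying code if the sets $J_C(v)$, $v \in V(G)$, are all nonempty and pairwise distinct; a group identifying code is an identifying code that is a subgroup of $V(G)$. $\gamma^{\mathrm{GID}}(G)$ is the minimum cardinality of a group identifying code in $G$. -}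

module Defs where

open import Data.Nat using (ℕ; zero; suc; _+_; _*_; _∸_; _%_)
open import Data.Nat.DivMod using (m%n<n)
open import Data.Fin using (Fin; zero; suc; toℕ; fromℕ<)
open import Data.List using (List; length)
open import Data.List.Relation.Unary.Any using (Any)
open import Data.List.Relation.Unary.AllPairs using (AllPairs)
open import Data.Product using (Σ; _×_; ∃; _,_)
open import Data.Sum using (_⊎_)
open import Relation.Nullary using (¬_)
open import Relation.Binary.PropositionalEquality using (_≡_; _≢_)
open import Function.Bundles using (_⇔_)

Σᶠ : (n : ℕ) → (Fin n → ℕ) → ℕ
Σᶠ zero f = 0
Σᶠ (suc n) f = f zero + Σᶠ n (λ i → f (suc i))

Πᶠ : (n : ℕ) → (Fin n → ℕ) → ℕ
Πᶠ zero f = 1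
Πᶠ (suc n) f = f zero * Πᶠ n (λ i → f (suc i))

0ₘ : ∀ {k} → Fin (suc k)
0ₘ = zero

_+ₘ_ : ∀ {k} → Fin k → Fin k → Fin k
_+ₘ_ {suc k} a b = fromℕ< (m%n<n (toℕ a + toℕ b) (suc k))

-ₘ_ : ∀ {k} → Fin k → Fin k
-ₘ_ {suc k} a = fromℕ< (m%n<n (suc k ∸ toℕ a) (suc k))

module Hamming (n : ℕ) (m : Fin n → ℕ) where

  Vertex : Set
  Vertex = (i : Fin n) → Fin (m i)

  _≈_ : Vertex → Vertex → Set
  u ≈ v = ∀ i → u i ≡ v i

  _⊕_ : Vertex → Vertex → Vertex
  (u ⊕ v) i = u i +ₘ v i

  ⊖_ : Vertex → Vertex
  (⊖ u) i = -ₘ (u i)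

  Adj : Vertex → Vertex → Set
  Adj u v = Σ (Fin n) λ i → (u i ≢ v i) × (∀ j → j ≢ i → u j ≡ v j)

  N[_] : Vertex → Vertex → Set
  N[ v ] u = (u ≈ v) ⊎ Adj v u

  record VSet : Set where
    field
      elems    : List Vertex
      distinct : AllPairs (λ x y → ¬ (x ≈ y)) elems

  open VSet public

  _∈C_ : Vertex → VSet → Set
  x ∈C C = Any (λ c → x ≈ c) (elems C)

  ∣_∣ : VSet → ℕ
  ∣ C ∣ = length (elems C)

  J : VSet → Vertex → Vertex → Set
  J C v u = N[ v ] u × (u ∈C C)

  IsIdentifyingCode : VSet → Set
  IsIdentifyingCode C =
    (∀ v → ∃ λ u → J C v u) ×
    (∀ v w → ¬ (v ≈ w) → ∃ λ u → ¬ (J C v u ⇔ J C w u))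

  IsSubgroup : VSet → Set
  IsSubgroup C =
    (∃ λ e → (e ∈C C) × (∀ i → toℕ (e i) ≡ 0)) ×
    (∀ x y → x ∈C C → y ∈C C → (x ⊕ y) ∈C C) ×
    (∀ x → x ∈C C → (⊖ x) ∈C C)

  IsGroupIdentifyingCode : VSet → Set
  IsGroupIdentifyingCode C = IsSubgroup C × IsIdentifyingCode C

-- No vertex v sees exactly two codewords c₁ ≠ c₂:
-- the reflection x ↦ c₁ + c₂ − x is a graph automorphism preserving C and swapping
-- c₁, c₂, so it fixes J_C(v) and hence v; thus 2v = c₁ + c₂, which puts c₂ on the
-- line through v and c₁. Then 2c₂ − c₁ ∈ C lies in N[v] as well, and either it equals
-- c₂, or the translation by c₂ − c₁ is an involution swapping c₁ and c₂, which then
-- fixes v; both force c₁ = c₂.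
-- So every J_C(v) has one or at least three elements, and at most ∣C∣ vertices have
-- one (J_C is injective). Double counting the pairs (c, v) with c ∈ N[v] gives
-- 3 ∏ mᵢ ≤ ∣C∣ (1 + Σ (mᵢ − 1)) + 2 ∣C∣.
module Submission where

open import Defs
open import Data.Nat using (ℕ; _+_; _*_; _∸_; _≤_)
open import Data.Fin using (Fin)

open import Algebra.Bundles using (AbelianGroup)
import Algebra.Properties.AbelianGroup as AbelianGroupProperties
open import Data.Empty using (⊥-elim)
open import Data.Fin.Base using (zero; suc; toℕ; punchOut; splitAt; _↑ˡ_; _↑ʳ_; remQuot; combine)
open import Data.Fin.Patterns using (0F; 1F; 2F)
open import Data.Fin.Properties
  using (toℕ-fromℕ<; toℕ-injective; toℕ<n; suc-injective; punchOut-injective; splitAt-↑ˡ; splitAt-↑ʳ;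
         combine-remQuot; injective⇒≤; all?; any?; +↔⊎; *↔×)
  renaming (_≟_ to _≟ᶠ_)
open import Data.List.Base using (_∷_; lookup)
import Data.List.Relation.Unary.All as All
open import Data.List.Relation.Unary.AllPairs using (AllPairs; _∷_)
open import Data.List.Relation.Unary.Any using (index)
open import Data.List.Relation.Unary.Any.Properties using (lookup-index)
import Data.List.Membership.Propositional.Properties as ∈ₚ
import Data.List.Membership.Setoid.Properties as ∈ₛ
import Data.Nat.Base as ℕ
open import Data.Nat.Base using (NonZero; _%_)
open import Data.Nat.DivMod using (%-distribˡ-+; m%n%n≡m%n; n%n≡0; m<n⇒m%n≡m)
open import Data.Nat.Properties using (+-comm; +-assoc; *-comm; m+[n∸m]≡n; m+n∸m≡n; <⇒≤; ≤-trans; module ≤-Reasoning)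
open import Data.Nat.Solver using (module +-*-Solver)
open import Data.Product.Base using (Σ; _×_; ∃; _,_; proj₁; proj₂; uncurry)
import Data.Product.Base as Product
open import Data.Product.Properties using (Σ-≡,≡←≡; ×-≡,≡←≡)
open import Data.Sum.Base using (_⊎_; inj₁; inj₂; [_,_])
import Data.Sum.Base as Sum
open import Data.Sum.Properties using (inj₁-injective; inj₂-injective)
open import Data.Sum.Function.Propositional using (_⊎-↔_)
open import Data.Vec.Base using ([]; _∷_)
import Data.Vec.Base as Vec
open import Function.Base using (_∘_; id)
open import Function.Bundles using (_⇔_; mk⇔; Equivalence; _↣_; mk↣; Injection)
open import Function.Construct.Composition using (_↣-∘_; _↔-∘_)
open import Function.Definitions using (Injective)
open import Function.Properties.Inverse using (↔⇒↣; ↔-sym)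
open import Level using (0ℓ)
open import Relation.Binary.Bundles using (Setoid)
open import Relation.Binary.Definitions using (Decidable)
open import Relation.Binary.PropositionalEquality hiding ([_]; J)
open import Relation.Nullary using (¬_; yes; no; contradiction)
open import Relation.Nullary.Decidable using (¬?; _×-dec_; _⊎-dec_; _→-dec_)
import Relation.Unary as Unary

open Equivalence using (to; from)

private
  [m%d+n]%d≡[m+n]%d : ∀ m n d .{{_ : NonZero d}} → (m % d + n) % d ≡ (m + n) % d
  [m%d+n]%d≡[m+n]%d m n d = begin
    (m % d + n) % d          ≡⟨ %-distribˡ-+ (m % d) n d ⟩
    (m % d % d + n % d) % d  ≡⟨ cong (λ x → (x + n % d) % d) (m%n%n≡m%n m d) ⟩
    (m % d + n % d) % d      ≡⟨ %-distribˡ-+ m n d ⟨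
    (m + n) % d              ∎
    where open ≡-Reasoning

  [m+n%d]%d≡[m+n]%d : ∀ m n d .{{_ : NonZero d}} → (m + n % d) % d ≡ (m + n) % d
  [m+n%d]%d≡[m+n]%d m n d = begin
    (m + n % d) % d  ≡⟨ cong (_% d) (+-comm m (n % d)) ⟩
    (n % d + m) % d  ≡⟨ [m%d+n]%d≡[m+n]%d n m d ⟩
    (n + m) % d      ≡⟨ cong (_% d) (+-comm n m) ⟩
    (m + n) % d      ∎
    where open ≡-Reasoning

toℕ-+ₘ : ∀ {k} (a b : Fin (ℕ.suc k)) → toℕ (a +ₘ b) ≡ (toℕ a + toℕ b) % ℕ.suc k
toℕ-+ₘ a b = toℕ-fromℕ< _

toℕ--ₘ : ∀ {k} (a : Fin (ℕ.suc k)) → toℕ (-ₘ a) ≡ (ℕ.suc k ∸ toℕ a) % ℕ.suc k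
toℕ--ₘ a = toℕ-fromℕ< _

+ₘ-comm : ∀ {k} (a b : Fin k) → a +ₘ b ≡ b +ₘ a
+ₘ-comm {ℕ.suc k} a b = toℕ-injective (begin
  toℕ (a +ₘ b)                ≡⟨ toℕ-+ₘ a b ⟩
  (toℕ a + toℕ b) % ℕ.suc k   ≡⟨ cong (_% ℕ.suc k) (+-comm (toℕ a) (toℕ b)) ⟩
  (toℕ b + toℕ a) % ℕ.suc k   ≡⟨ toℕ-+ₘ b a ⟨
  toℕ (b +ₘ a)                ∎)
  where open ≡-Reasoning

+ₘ-assoc : ∀ {k} (a b c : Fin k) → (a +ₘ b) +ₘ c ≡ a +ₘ (b +ₘ c)
+ₘ-assoc {ℕ.suc k} a b c = toℕ-injective (begin
  toℕ ((a +ₘ b) +ₘ c)                     ≡⟨ toℕ-+ₘ (a +ₘ b) c ⟩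
  (toℕ (a +ₘ b) + toℕ c) % d              ≡⟨ cong (λ x → (x + toℕ c) % d) (toℕ-+ₘ a b) ⟩
  ((toℕ a + toℕ b) % d + toℕ c) % d       ≡⟨ [m%d+n]%d≡[m+n]%d (toℕ a + toℕ b) (toℕ c) d ⟩
  (toℕ a + toℕ b + toℕ c) % d             ≡⟨ cong (_% d) (+-assoc (toℕ a) (toℕ b) (toℕ c)) ⟩
  (toℕ a + (toℕ b + toℕ c)) % d           ≡⟨ [m+n%d]%d≡[m+n]%d (toℕ a) (toℕ b + toℕ c) d ⟨
  (toℕ a + (toℕ b + toℕ c) % d) % d       ≡⟨ cong (λ x → (toℕ a + x) % d) (toℕ-+ₘ b c) ⟨
  (toℕ a + toℕ (b +ₘ c)) % d              ≡⟨ toℕ-+ₘ a (b +ₘ c) ⟨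
  toℕ (a +ₘ (b +ₘ c))                     ∎)
  where
    open ≡-Reasoning
    d = ℕ.suc k

+ₘ-identityʳ : ∀ {k} {z : Fin k} → toℕ z ≡ 0 → ∀ a → a +ₘ z ≡ a
+ₘ-identityʳ {ℕ.suc k} {z} z≡0 a = toℕ-injective (begin
  toℕ (a +ₘ z)                ≡⟨ toℕ-+ₘ a z ⟩
  (toℕ a + toℕ z) % ℕ.suc k   ≡⟨ cong (λ x → (toℕ a + x) % ℕ.suc k) z≡0 ⟩
  (toℕ a + 0) % ℕ.suc k       ≡⟨ cong (_% ℕ.suc k) (+-comm (toℕ a) 0) ⟩
  toℕ a % ℕ.suc k             ≡⟨ m<n⇒m%n≡m (toℕ<n a) ⟩
  toℕ a                       ∎)
  where open ≡-Reasoning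

toℕ-+ₘ-inverseʳ : ∀ {k} (a : Fin k) → toℕ (a +ₘ (-ₘ a)) ≡ 0
toℕ-+ₘ-inverseʳ {ℕ.suc k} a = begin
  toℕ (a +ₘ (-ₘ a))                   ≡⟨ toℕ-+ₘ a (-ₘ a) ⟩
  (toℕ a + toℕ (-ₘ a)) % d            ≡⟨ cong (λ x → (toℕ a + x) % d) (toℕ--ₘ a) ⟩
  (toℕ a + (d ∸ toℕ a) % d) % d       ≡⟨ [m+n%d]%d≡[m+n]%d (toℕ a) (d ∸ toℕ a) d ⟩
  (toℕ a + (d ∸ toℕ a)) % d           ≡⟨ cong (_% d) (m+[n∸m]≡n (<⇒≤ (toℕ<n a))) ⟩
  d % d                               ≡⟨ n%n≡0 d ⟩
  0                                   ∎
  where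
    open ≡-Reasoning
    d = ℕ.suc k

-- The zero is supplied as any z with toℕ z ≡ 0, so k need not be visibly a successor.
+ₘ-abelianGroup : ∀ {k} (z : Fin k) → toℕ z ≡ 0 → AbelianGroup 0ℓ 0ℓ
+ₘ-abelianGroup {k} z z≡0 = record
  { Carrier = Fin k
  ; _≈_ = _≡_
  ; _∙_ = _+ₘ_
  ; ε = z
  ; _⁻¹ = -ₘ_
  ; isAbelianGroup = record
    { isGroup = record
      { isMonoid = record
        { isSemigroup = record
          { isMagma = record { isEquivalence = isEquivalence ; ∙-cong = cong₂ _+ₘ_ }
          ; assoc = +ₘ-assoc
          }
        ; identity = (λ a → trans (+ₘ-comm z a) (+ₘ-identityʳ z≡0 a)) , +ₘ-identityʳ z≡0
        }
      ; inverse = (λ a → trans (+ₘ-comm (-ₘ a) a) (inverseʳ a)) , inverseʳ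
      ; ⁻¹-cong = cong -ₘ_
      }
    ; comm = +ₘ-comm
    }
  }
  where
    inverseʳ : ∀ a → a +ₘ (-ₘ a) ≡ z
    inverseʳ a = toℕ-injective (trans (toℕ-+ₘ-inverseʳ a) (sym z≡0))

injectΣᶠ : (n : ℕ) (f : Fin n → ℕ) → Σ (Fin n) (Fin ∘ f) → Fin (Σᶠ n f)
injectΣᶠ (ℕ.suc n) f (zero , a)  = a ↑ˡ Σᶠ n (f ∘ suc)
injectΣᶠ (ℕ.suc n) f (suc i , a) = f zero ↑ʳ injectΣᶠ n (f ∘ suc) (i , a)

projectΣᶠ : (n : ℕ) (f : Fin n → ℕ) → Fin (Σᶠ n f) → Σ (Fin n) (Fin ∘ f)
projectΣᶠ (ℕ.suc n) f x =
  [ (λ a → zero , a) , Product.map suc id ∘ projectΣᶠ n (f ∘ suc) ] (splitAt (f zero) x)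

projectΣᶠ-injectΣᶠ : ∀ n f x → projectΣᶠ n f (injectΣᶠ n f x) ≡ x
projectΣᶠ-injectΣᶠ (ℕ.suc n) f (zero , a)
  rewrite splitAt-↑ˡ (f zero) a (Σᶠ n (f ∘ suc)) = refl
projectΣᶠ-injectΣᶠ (ℕ.suc n) f (suc i , a)
  rewrite splitAt-↑ʳ (f zero) (Σᶠ n (f ∘ suc)) (injectΣᶠ n (f ∘ suc) (i , a))
        | projectΣᶠ-injectΣᶠ n (f ∘ suc) (i , a) = refl

injectΣᶠ-injective : ∀ n f → Injective _≡_ _≡_ (injectΣᶠ n f)
injectΣᶠ-injective n f {x} {y} eq = begin
  x                                ≡⟨ projectΣᶠ-injectΣᶠ n f x ⟨
  projectΣᶠ n f (injectΣᶠ n f x)   ≡⟨ cong (projectΣᶠ n f) eq ⟩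
  projectΣᶠ n f (injectΣᶠ n f y)   ≡⟨ projectΣᶠ-injectΣᶠ n f y ⟩
  y                                ∎
  where open ≡-Reasoning

decodeΠᶠ : (n : ℕ) (m : Fin n → ℕ) → Fin (Πᶠ n m) → (i : Fin n) → Fin (m i)
decodeΠᶠ (ℕ.suc n) m p zero    = proj₁ (remQuot {m zero} (Πᶠ n (m ∘ suc)) p)
decodeΠᶠ (ℕ.suc n) m p (suc i) = decodeΠᶠ n (m ∘ suc) (proj₂ (remQuot {m zero} (Πᶠ n (m ∘ suc)) p)) i

decodeΠᶠ-injective : ∀ n m {p q} → (∀ i → decodeΠᶠ n m p i ≡ decodeΠᶠ n m q i) → p ≡ q
decodeΠᶠ-injective ℕ.zero m {zero} {zero} _ = refl
decodeΠᶠ-injective (ℕ.suc n) m {p} {q} same = begin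
  p                                      ≡⟨ combine-remQuot {m zero} k p ⟨
  uncurry combine (remQuot {m zero} k p) ≡⟨ cong₂ combine (same zero) (decodeΠᶠ-injective n (m ∘ suc) (same ∘ suc)) ⟩
  uncurry combine (remQuot {m zero} k q) ≡⟨ combine-remQuot {m zero} k q ⟩
  q                                      ∎
  where
    open ≡-Reasoning
    k = Πᶠ n (m ∘ suc)

punchOut′ : ∀ {k} {a b : Fin k} → a ≢ b → Fin (k ∸ 1)
punchOut′ {ℕ.suc k} = punchOut

punchOut′-injective : ∀ {k} {a b c : Fin k} (a≢b : a ≢ b) (a≢c : a ≢ c) → punchOut′ a≢b ≡ punchOut′ a≢c → b ≡ c
punchOut′-injective {ℕ.suc k} = punchOut-injective

injective-on-three : ∀ {A : Set} {a b c : A} → a ≢ b → a ≢ c → b ≢ c →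
                     Injective _≡_ _≡_ (Vec.lookup (a ∷ b ∷ c ∷ []))
injective-on-three a≢b a≢c b≢c {0F} {0F} _  = refl
injective-on-three a≢b a≢c b≢c {0F} {1F} eq = contradiction eq a≢b
injective-on-three a≢b a≢c b≢c {0F} {2F} eq = contradiction eq a≢c
injective-on-three a≢b a≢c b≢c {1F} {0F} eq = contradiction (sym eq) a≢b
injective-on-three a≢b a≢c b≢c {1F} {1F} _  = refl
injective-on-three a≢b a≢c b≢c {1F} {2F} eq = contradiction eq b≢c
injective-on-three a≢b a≢c b≢c {2F} {0F} eq = contradiction (sym eq) a≢c
injective-on-three a≢b a≢c b≢c {2F} {1F} eq = contradiction (sym eq) b≢c
injective-on-three a≢b a≢c b≢c {2F} {2F} _  = refl

data Census {K : ℕ} (P : Fin K → Set) : Set where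
  none  : (∀ j → ¬ P j) → Census P
  one   : ∀ a → P a → (∀ j → P j → j ≡ a) → Census P
  two   : ∀ a b → a ≢ b → P a → P b → (∀ j → P j → j ≡ a ⊎ j ≡ b) → Census P
  three : (x : Fin 3 → Fin K) → Injective _≡_ _≡_ x → (∀ k → P (x k)) → Census P

census : ∀ {K} (P : Fin K → Set) → Unary.Decidable P → Census P
census {ℕ.zero} P P? = none λ ()
census {ℕ.suc K} P P? with P? zero | census (P ∘ suc) (P? ∘ suc)
... | _ | three x x-inj px = three (suc ∘ x) (x-inj ∘ suc-injective) px
... | no ¬p₀ | none ¬p = none λ { zero → ¬p₀ ; (suc j) → ¬p j }
... | no ¬p₀ | one a pa only =
  one (suc a) pa λ { zero p₀ → contradiction p₀ ¬p₀ ; (suc j) pj → cong suc (only j pj) }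
... | no ¬p₀ | two a b a≢b pa pb only =
  two (suc a) (suc b) (a≢b ∘ suc-injective) pa pb
    λ { zero p₀ → contradiction p₀ ¬p₀ ; (suc j) pj → Sum.map (cong suc) (cong suc) (only j pj) }
... | yes p₀ | none ¬p =
  one zero p₀ λ { zero _ → refl ; (suc j) pj → contradiction pj (¬p j) }
... | yes p₀ | one a pa only =
  two zero (suc a) (λ ()) p₀ pa λ { zero _ → inj₁ refl ; (suc j) pj → inj₂ (cong suc (only j pj)) }
... | yes p₀ | two a b a≢b pa pb _ =
  three (Vec.lookup (zero ∷ suc a ∷ suc b ∷ [])) (injective-on-three (λ ()) (λ ()) (a≢b ∘ suc-injective))
    λ { 0F → p₀ ; 1F → pa ; 2F → pb }

module _ (n : ℕ) (m : Fin n → ℕ) where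
  open Hamming n m

  ≈-setoid : Setoid 0ℓ 0ℓ
  ≈-setoid = record
    { Carrier = Vertex
    ; _≈_ = _≈_
    ; isEquivalence = record
      { refl = λ _ → refl ; sym = λ u≈v i → sym (u≈v i) ; trans = λ u≈v v≈w i → trans (u≈v i) (v≈w i) }
    }

  private module ≈ = Setoid ≈-setoid

  _≈?_ : Decidable _≈_
  u ≈? v = all? λ i → u i ≟ᶠ v i

  Adj? : Decidable Adj
  Adj? v u = any? λ i → ¬? (v i ≟ᶠ u i) ×-dec all? λ j → ¬? (j ≟ᶠ i) →-dec v j ≟ᶠ u j

  N? : ∀ v → Unary.Decidable N[ v ]
  N? v u = u ≈? v ⊎-dec Adj? v u

  ≈-fromAgreeingOff : ∀ i {u v} → u i ≡ v i → (∀ j → j ≢ i → u j ≡ v j) → u ≈ v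
  ≈-fromAgreeingOff i ui≡vi agree j with j ≟ᶠ i
  ... | yes refl = ui≡vi
  ... | no j≢i   = agree j j≢i

  N-fromAgreeingOff : ∀ i {u v} → (∀ j → j ≢ i → u j ≡ v j) → N[ v ] u
  N-fromAgreeingOff i {u} {v} agree with u i ≟ᶠ v i
  ... | yes ui≡vi = inj₁ (≈-fromAgreeingOff i ui≡vi agree)
  ... | no ui≢vi  = inj₂ (i , ui≢vi ∘ sym , λ j j≢i → sym (agree j j≢i))

  N-resp : ∀ {v v' u u'} → v ≈ v' → u ≈ u' → N[ v ] u → N[ v' ] u'
  N-resp v≈v' u≈u' (inj₁ u≈v) = inj₁ (≈.trans (≈.sym u≈u') (≈.trans u≈v v≈v'))
  N-resp v≈v' u≈u' (inj₂ (i , vi≢ui , agree)) =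
    inj₂ (i , (λ eq → vi≢ui (trans (v≈v' i) (trans eq (sym (u≈u' i)))))
            , λ j j≢i → trans (sym (v≈v' j)) (trans (agree j j≢i) (u≈u' j)))

  J-resp : ∀ {C v v' u u'} → v ≈ v' → u ≈ u' → J C v u → J C v' u'
  J-resp v≈v' u≈u' (Nu , u∈C) = N-resp v≈v' u≈u' Nu , ∈ₛ.∈-resp-≈ ≈-setoid u≈u' u∈C

  PreservesAgreement : (Vertex → Vertex) → Set
  PreservesAgreement φ = ∀ x y i → φ x i ≡ φ y i ⇔ x i ≡ y i

  module _ {φ : Vertex → Vertex} (φ-agree : PreservesAgreement φ) where

    ≈-preserved : ∀ {x y} → x ≈ y → φ x ≈ φ y
    ≈-preserved x≈y i = from (φ-agree _ _ i) (x≈y i)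

    N-preserved : ∀ {v u} → N[ v ] u → N[ φ v ] (φ u)
    N-preserved (inj₁ u≈v) = inj₁ (≈-preserved u≈v)
    N-preserved (inj₂ (i , vi≢ui , agree)) =
      inj₂ (i , vi≢ui ∘ to (φ-agree _ _ i) , λ j j≢i → from (φ-agree _ _ j) (agree j j≢i))

  degree : ℕ
  degree = Σᶠ n (λ i → m i ∸ 1)

  -- 0 for c itself, and otherwise the coordinate and new value of the neighbour v.
  neighbourCode : (c v : Vertex) → N[ v ] c → Fin (ℕ.suc degree)
  neighbourCode c v (inj₁ _) = zero
  neighbourCode c v (inj₂ (i , vi≢ci , _)) =
    suc (injectΣᶠ n (λ i → m i ∸ 1) (i , punchOut′ (vi≢ci ∘ sym)))

  neighbourCode-injective : ∀ {c v v'} (p : N[ v ] c) (p' : N[ v' ] c) →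
                            neighbourCode c v p ≡ neighbourCode c v' p' → v ≈ v'
  neighbourCode-injective (inj₁ c≈v) (inj₁ c≈v') _ = ≈.trans (≈.sym c≈v) c≈v'
  neighbourCode-injective (inj₂ (i , _ , agree)) (inj₂ (i' , _ , agree')) eq
    with Σ-≡,≡←≡ (injectΣᶠ-injective n _ (suc-injective eq))
  ... | refl , same = ≈-fromAgreeingOff i (punchOut′-injective _ _ same)
                        λ j j≢i → trans (agree j j≢i) (sym (agree' j j≢i))

  module _ {C : VSet} (idc : IsIdentifyingCode C) where

    J-injective : ∀ {v w} → (∀ u → J C v u ⇔ J C w u) → v ≈ w
    J-injective {v} {w} same with v ≈? w
    ... | yes v≈w = v≈w
    ... | no v≉w with proj₂ idc v w v≉w
    ...   | u , differ = ⊥-elim (differ (same u))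

    module _ {φ : Vertex → Vertex} (φ-agree : PreservesAgreement φ)
             (φ-involutive : ∀ x → φ (φ x) ≈ x) (φ-code : ∀ {x} → x ∈C C → φ x ∈C C) where

      J-preserved : ∀ {v u} → J C v u → J C (φ v) (φ u)
      J-preserved (Nu , u∈C) = N-preserved φ-agree Nu , φ-code u∈C

      J-invariant⇒fixed : ∀ {v} → (∀ {u} → J C v u → J C v (φ u)) → φ v ≈ v
      J-invariant⇒fixed {v} invariant = J-injective λ u → mk⇔ J[φv]⊆J[v] J[v]⊆J[φv]
        where
          J[φv]⊆J[v] : ∀ {u} → J C (φ v) u → J C v u
          J[φv]⊆J[v] {u} Ju =
            J-resp {C} ≈.refl (φ-involutive u) (invariant (J-resp {C} (φ-involutive v) ≈.refl (J-preserved Ju)))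
          J[v]⊆J[φv] : ∀ {u} → J C v u → J C (φ v) u
          J[v]⊆J[φv] {u} Ju = J-resp {C} ≈.refl (φ-involutive u) (J-preserved (invariant Ju))

      swaps⇒fixed : ∀ {v c₁ c₂} → (∀ u → J C v u ⇔ (u ≈ c₁ ⊎ u ≈ c₂)) → φ c₁ ≈ c₂ → φ v ≈ v
      swaps⇒fixed {v} {c₁} {c₂} pair φc₁≈c₂ =
        J-invariant⇒fixed λ {u} Ju → from (pair (φ u)) (swap (to (pair u) Ju))
        where
          φc₂≈c₁ : φ c₂ ≈ c₁
          φc₂≈c₁ = ≈.trans (≈-preserved φ-agree (≈.sym φc₁≈c₂)) (φ-involutive c₁)
          swap : ∀ {u} → u ≈ c₁ ⊎ u ≈ c₂ → φ u ≈ c₁ ⊎ φ u ≈ c₂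
          swap (inj₁ u≈c₁) = inj₂ (≈.trans (≈-preserved φ-agree u≈c₁) φc₁≈c₂)
          swap (inj₂ u≈c₂) = inj₁ (≈.trans (≈-preserved φ-agree u≈c₂) φc₂≈c₁)

  reflect : Vertex → Vertex → Vertex
  reflect d x = d ⊕ (⊖ x)

  translate : Vertex → Vertex → Vertex
  translate t x = x ⊕ t

  module _ {C : VSet} (sub : IsSubgroup C) where

    private
      o : Vertex
      o = proj₁ (proj₁ sub)

      ⊕-closed : ∀ {x y} → x ∈C C → y ∈C C → (x ⊕ y) ∈C C
      ⊕-closed = proj₁ (proj₂ sub) _ _

      ⊖-closed : ∀ {x} → x ∈C C → (⊖ x) ∈C C
      ⊖-closed = proj₂ (proj₂ sub) _

    ℤₘ : Fin n → AbelianGroup 0ℓ 0ℓ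
    ℤₘ i = +ₘ-abelianGroup (o i) (proj₂ (proj₂ (proj₁ sub)) i)

    module ℤₘ (i : Fin n) where
      open AbelianGroup (ℤₘ i) public
      open AbelianGroupProperties (ℤₘ i) public

    reflect-agree : ∀ d → PreservesAgreement (reflect d)
    reflect-agree d x y i =
      mk⇔ (ℤₘ.⁻¹-injective i ∘ ℤₘ.∙-cancelˡ i (d i) _ _) (cong (λ a → d i +ₘ (-ₘ a)))

    reflect-involutive : ∀ d x → reflect d (reflect d x) ≈ x
    reflect-involutive d x i = begin
      d i +ₘ (-ₘ (d i - x i))  ≡⟨ cong (d i +ₘ_) (⁻¹-anti-homo‿- (d i) (x i)) ⟩
      d i +ₘ (x i - d i)       ≡⟨ comm (d i) _ ⟩
      (x i - d i) +ₘ d i       ≡⟨ //-rightDividesˡ (d i) (x i) ⟩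
      x i                      ∎
      where
        open ≡-Reasoning
        open ℤₘ i using (_-_; comm; ⁻¹-anti-homo‿-; //-rightDividesˡ)

    reflect-code : ∀ {d x} → d ∈C C → x ∈C C → reflect d x ∈C C
    reflect-code d∈C x∈C = ⊕-closed d∈C (⊖-closed x∈C)

    translate-agree : ∀ t → PreservesAgreement (translate t)
    translate-agree t x y i = mk⇔ (ℤₘ.∙-cancelʳ i (t i) _ _) (cong (_+ₘ t i))

    translate-involutive : ∀ {t} → (∀ i → t i +ₘ t i ≡ o i) → ∀ x → translate t (translate t x) ≈ x
    translate-involutive {t} t+t≡o x i = begin
      (x i +ₘ t i) +ₘ t i  ≡⟨ ℤₘ.assoc i (x i) (t i) (t i) ⟩
      x i +ₘ (t i +ₘ t i)  ≡⟨ cong (x i +ₘ_) (t+t≡o i) ⟩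
      x i +ₘ o i           ≡⟨ ℤₘ.identityʳ i (x i) ⟩
      x i                  ∎
      where open ≡-Reasoning

    translate-code : ∀ {t x} → t ∈C C → x ∈C C → translate t x ∈C C
    translate-code t∈C x∈C = ⊕-closed x∈C t∈C

    module _ (idc : IsIdentifyingCode C) {v c₁ c₂ : Vertex} (pair : ∀ u → J C v u ⇔ (u ≈ c₁ ⊎ u ≈ c₂)) where

      private
        c₁∈C : c₁ ∈C C
        c₁∈C = proj₂ (from (pair c₁) (inj₁ ≈.refl))

        c₂∈C : c₂ ∈C C
        c₂∈C = proj₂ (from (pair c₂) (inj₂ ≈.refl))

        t : Vertex
        t = c₂ ⊕ (⊖ c₁)

        t∈C : t ∈C C
        t∈C = ⊕-closed c₂∈C (⊖-closed c₁∈C)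

        c₁+t≈c₂ : translate t c₁ ≈ c₂
        c₁+t≈c₂ i = trans (ℤₘ.comm i (c₁ i) (t i)) (ℤₘ.//-rightDividesˡ i (c₁ i) (c₂ i))

      exact-pair⇒midpoint : ∀ i → c₁ i +ₘ c₂ i ≡ v i +ₘ v i
      exact-pair⇒midpoint i = begin
        c₁ i +ₘ c₂ i                               ≡⟨ ℤₘ.//-rightDividesˡ i (v i) _ ⟨
        ((c₁ i +ₘ c₂ i) +ₘ (-ₘ v i)) +ₘ v i        ≡⟨ cong (_+ₘ v i) (reflection-fixes i) ⟩
        v i +ₘ v i                                 ∎
        where
          open ≡-Reasoning
          reflection-fixes : reflect (c₁ ⊕ c₂) v ≈ v
          reflection-fixes =
            swaps⇒fixed {C} idc (reflect-agree _) (reflect-involutive _) (reflect-code (⊕-closed c₁∈C c₂∈C))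
              pair (λ i → ℤₘ.xyx⁻¹≈y i (c₁ i) (c₂ i))

      exact-pair⇒agree : ∀ j → c₁ j ≡ v j → c₂ j ≡ v j
      exact-pair⇒agree j c₁j≡vj =
        ℤₘ.∙-cancelˡ j (v j) (c₂ j) (v j) (trans (cong (_+ₘ c₂ j) (sym c₁j≡vj)) (exact-pair⇒midpoint j))

      exact-pair⇒difference≈o : translate t c₂ ≈ c₁ ⊎ translate t c₂ ≈ c₂ → ∀ i → t i ≡ o i
      exact-pair⇒difference≈o (inj₂ c₂+t≈c₂) i = ℤₘ.identityʳ-unique i (c₂ i) (t i) (c₂+t≈c₂ i)
      exact-pair⇒difference≈o (inj₁ c₂+t≈c₁) i = ℤₘ.identityʳ-unique i (v i) (t i) (translation-fixes i)
        where
          t+t≡o : ∀ i → t i +ₘ t i ≡ o i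
          t+t≡o i = ℤₘ.identityʳ-unique i (c₁ i) _ (begin
            c₁ i +ₘ (t i +ₘ t i)   ≡⟨ ℤₘ.assoc i (c₁ i) (t i) (t i) ⟨
            (c₁ i +ₘ t i) +ₘ t i   ≡⟨ cong (_+ₘ t i) (c₁+t≈c₂ i) ⟩
            c₂ i +ₘ t i            ≡⟨ c₂+t≈c₁ i ⟩
            c₁ i                   ∎)
            where open ≡-Reasoning
          translation-fixes : translate t v ≈ v
          translation-fixes =
            swaps⇒fixed {C} idc (translate-agree t) (translate-involutive t+t≡o) (translate-code t∈C)
              pair c₁+t≈c₂

      exact-pair⇒≈ : c₁ ≈ c₂
      exact-pair⇒≈ = cases (proj₁ (from (pair c₁) (inj₁ ≈.refl)))
        where
          cases : N[ v ] c₁ → c₁ ≈ c₂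
          cases (inj₁ c₁≈v) i = trans (c₁≈v i) (sym (exact-pair⇒agree i (c₁≈v i)))
          cases (inj₂ (i , _ , agree)) j = begin
            c₁ j          ≡⟨ ℤₘ.identityʳ j (c₁ j) ⟨
            c₁ j +ₘ o j   ≡⟨ cong (c₁ j +ₘ_) (t≈o j) ⟨
            c₁ j +ₘ t j   ≡⟨ c₁+t≈c₂ j ⟩
            c₂ j          ∎
            where
              open ≡-Reasoning
              p-agrees : ∀ j → j ≢ i → translate t c₂ j ≡ v j
              p-agrees j j≢i = trans (cong (c₂ j +ₘ_) (ℤₘ.x≈y⇒x∙y⁻¹≈ε j (trans c₂j≡vj (agree j j≢i))))
                                     (trans (ℤₘ.identityʳ j (c₂ j)) c₂j≡vj)
                where c₂j≡vj = exact-pair⇒agree j (sym (agree j j≢i))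
              t≈o : ∀ j → t j ≡ o j
              t≈o = exact-pair⇒difference≈o
                      (to (pair _) (N-fromAgreeingOff i p-agrees , translate-code t∈C c₂∈C))

  lookup-injective : ∀ xs → AllPairs (λ x y → ¬ x ≈ y) xs → ∀ {a b} → lookup xs a ≈ lookup xs b → a ≡ b
  lookup-injective (x ∷ xs) (_ ∷ _)   {zero}  {zero}  _   = refl
  lookup-injective (x ∷ xs) (x≉ ∷ _)  {zero}  {suc b} x≈  = contradiction x≈ (All.lookup x≉ (∈ₚ.∈-lookup b))
  lookup-injective (x ∷ xs) (x≉ ∷ _)  {suc a} {zero}  ≈x  = contradiction (≈.sym ≈x) (All.lookup x≉ (∈ₚ.∈-lookup a))
  lookup-injective (x ∷ xs) (_ ∷ xs≉) {suc a} {suc b} eq  = cong suc (lookup-injective xs xs≉ eq)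

  module _ {C : VSet} (sub : IsSubgroup C) (idc : IsIdentifyingCode C) where

    codeword : Fin ∣ C ∣ → Vertex
    codeword = lookup (elems C)

    Sees : Vertex → Fin ∣ C ∣ → Set
    Sees v j = N[ v ] (codeword j)

    Sees⇒J : ∀ {v u j} → Sees v j → u ≈ codeword j → J C v u
    Sees⇒J {j = j} s u≈cj = N-resp ≈.refl (≈.sym u≈cj) s , ∈ₛ.∈-resp-≈ ≈-setoid (≈.sym u≈cj) (∈ₛ.∈-lookup ≈-setoid (elems C) j)

    J⇒Sees : ∀ {v u} → J C v u → ∃ λ j → u ≈ codeword j × Sees v j
    J⇒Sees (Nu , u∈C) = index u∈C , lookup-index u∈C , N-resp ≈.refl (lookup-index u∈C) Nu

    data Sighting (v : Vertex) : Set where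
      one   : ∀ a → Sees v a → (∀ j → Sees v j → j ≡ a) → Sighting v
      three : (x : Fin 3 → Fin ∣ C ∣) → Injective _≡_ _≡_ x → (∀ k → Sees v (x k)) → Sighting v

    sighting : ∀ v → Sighting v
    sighting v with census (Sees v) (N? v ∘ codeword)
    ... | none unseen = let j , _ , s = J⇒Sees (proj₂ (proj₁ idc v)) in contradiction s (unseen j)
    ... | one a sa only = one a sa only
    ... | two a b a≢b sa sb only = contradiction (lookup-injective (elems C) (distinct C) (exact-pair⇒≈ {C} sub idc pair)) a≢b
      where
        pair : ∀ u → J C v u ⇔ (u ≈ codeword a ⊎ u ≈ codeword b)
        pair u = mk⇔ J⇒pair [ Sees⇒J sa , Sees⇒J sb ]
          where
            J⇒pair : J C v u → u ≈ codeword a ⊎ u ≈ codeword b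
            J⇒pair Ju with J⇒Sees Ju
            ... | j , u≈cj , s = Sum.map (λ j≡a → subst (λ i → u ≈ codeword i) j≡a u≈cj)
                                         (λ j≡b → subst (λ i → u ≈ codeword i) j≡b u≈cj) (only j s)
    ... | three x x-inj sx = three x x-inj sx

    Label : Set
    Label = (Fin ∣ C ∣ × Fin (ℕ.suc degree)) ⊎ (Fin 2 × Fin ∣ C ∣)

    -- A vertex seeing a single codeword a fills two slots with (0, a) and (1, a); since J_C is
    -- injective, no other vertex sees exactly a.
    label : ∀ v → Sighting v → Fin 3 → Label
    label v (one a sa _) 0F   = inj₁ (a , neighbourCode (codeword a) v sa)
    label v (one a _ _)  1F   = inj₂ (0F , a)
    label v (one a _ _)  2F   = inj₂ (1F , a)
    label v (three x _ sx) k  = inj₁ (x k , neighbourCode (codeword (x k)) v (sx k))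

    data Valid (v : Vertex) : Label → Set where
      seen : ∀ j (s : Sees v j) → Valid v (inj₁ (j , neighbourCode (codeword j) v s))
      sole : ∀ b {j} → Sees v j → (∀ j' → Sees v j' → j' ≡ j) → Valid v (inj₂ (b , j))

    label-valid : ∀ v σ k → Valid v (label v σ k)
    label-valid v (one a sa only) 0F = seen a sa
    label-valid v (one a sa only) 1F = sole 0F sa only
    label-valid v (one a sa only) 2F = sole 1F sa only
    label-valid v (three x _ sx)  k  = seen (x k) (sx k)

    sole⇒J⊆ : ∀ {v v' j} → Sees v j → (∀ j' → Sees v j' → j' ≡ j) → Sees v' j → ∀ {u} → J C v u → J C v' u
    sole⇒J⊆ {v' = v'} _ only s' Ju with J⇒Sees Ju
    ... | j' , u≈cj' , sj' = Sees⇒J (subst (Sees v') (sym (only j' sj')) s') u≈cj'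

    Valid-injective : ∀ {v v' ℓ ℓ'} → Valid v ℓ → Valid v' ℓ' → ℓ ≡ ℓ' → v ≈ v'
    Valid-injective (seen _ s) (seen _ s') eq with ×-≡,≡←≡ (inj₁-injective eq)
    ... | refl , same = neighbourCode-injective s s' same
    Valid-injective (sole _ s only) (sole _ s' only') eq with ×-≡,≡←≡ (inj₂-injective eq)
    ... | _ , refl = J-injective {C} idc λ u → mk⇔ (sole⇒J⊆ s only s') (sole⇒J⊆ s' only' s)
    Valid-injective (seen _ _)     (sole _ _ _) ()
    Valid-injective (sole _ _ _)   (seen _ _)   ()

    slot : Label → Fin 3
    slot (inj₁ _)       = 0F
    slot (inj₂ (b , _)) = suc b

    label-injective : ∀ v σ {k k'} → label v σ k ≡ label v σ k' → k ≡ k'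
    label-injective v σ@(one _ _ _) {k} {k'} eq =
      trans (sym (slot-label k)) (trans (cong slot eq) (slot-label k'))
      where
        slot-label : ∀ k → slot (label v σ k) ≡ k
        slot-label 0F = refl
        slot-label 1F = refl
        slot-label 2F = refl
    label-injective v (three x x-inj _) eq = x-inj (proj₁ (×-≡,≡←≡ (inj₁-injective eq)))

    labelling : Fin (Πᶠ n m) × Fin 3 → Label
    labelling (p , k) = label (decodeΠᶠ n m p) (sighting _) k

    labelling-injective : Injective _≡_ _≡_ labelling
    labelling-injective {p , k} {p' , k'} eq
      with decodeΠᶠ-injective n m (Valid-injective (label-valid _ _ k) (label-valid _ _ k') eq)
    ... | refl = cong (p ,_) (label-injective _ _ eq)

    groupIdentifyingCode-bound : 3 * Πᶠ n m ≤ ∣ C ∣ * (degree + 3)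
    groupIdentifyingCode-bound = begin
      3 * Πᶠ n m                            ≡⟨ *-comm 3 (Πᶠ n m) ⟩
      Πᶠ n m * 3                            ≤⟨ injective⇒≤ (Injection.injective labels) ⟩
      ∣ C ∣ * ℕ.suc degree + 2 * ∣ C ∣      ≡⟨ solve 2 (λ c d → c :* (con 1 :+ d) :+ con 2 :* c := c :* (d :+ con 3)) refl ∣ C ∣ degree ⟩
      ∣ C ∣ * (degree + 3)                  ∎
      where
        open ≤-Reasoning
        open +-*-Solver
        labels : Fin (Πᶠ n m * 3) ↣ Fin (∣ C ∣ * ℕ.suc degree + 2 * ∣ C ∣)
        labels = ↔⇒↣ (↔-sym ((*↔× ⊎-↔ *↔×) ↔-∘ +↔⊎)) ↣-∘ (mk↣ labelling-injective ↣-∘ ↔⇒↣ *↔×)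

Σᶠ≡n+Σᶠ∸1 : ∀ n (f : Fin n → ℕ) → (∀ i → 1 ≤ f i) → Σᶠ n f ≡ n + Σᶠ n (λ i → f i ∸ 1)
Σᶠ≡n+Σᶠ∸1 ℕ.zero f _ = refl
Σᶠ≡n+Σᶠ∸1 (ℕ.suc n) f 1≤f = begin
  f zero + Σᶠ n (f ∘ suc)               ≡⟨ cong₂ _+_ (sym (m+[n∸m]≡n (1≤f zero))) (Σᶠ≡n+Σᶠ∸1 n (f ∘ suc) (1≤f ∘ suc)) ⟩
  (1 + (f zero ∸ 1)) + (n + s)          ≡⟨ solve 3 (λ a n s → (con 1 :+ a) :+ (n :+ s) := (con 1 :+ n) :+ (a :+ s)) refl (f zero ∸ 1) n s ⟩
  ℕ.suc n + (f zero ∸ 1 + s)            ∎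
  where
    open ≡-Reasoning
    open +-*-Solver
    s = Σᶠ n (λ i → f (suc i) ∸ 1)

corollary3p9 : (n : ℕ) (m : Fin n → ℕ) → 3 ≤ n → (∀ i → 3 ≤ m i) →
    (C : Hamming.VSet n m) → Hamming.IsGroupIdentifyingCode n m C →
    3 * Πᶠ n m ≤ Hamming.∣_∣ n m C * ((Σᶠ n m ∸ n) + 3)
corollary3p9 n m _ 3≤m C (sub , idc) = begin
  3 * Πᶠ n m                  ≤⟨ groupIdentifyingCode-bound n m {C} sub idc ⟩
  ∣ C ∣ * (degree n m + 3)    ≡⟨ cong (λ d → ∣ C ∣ * (d + 3)) Σᶠ∸n≡degree ⟨
  ∣ C ∣ * ((Σᶠ n m ∸ n) + 3)  ∎
  where
    open ≤-Reasoning
    open Hamming n m using (∣_∣)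
    Σᶠ∸n≡degree : Σᶠ n m ∸ n ≡ degree n m
    Σᶠ∸n≡degree = trans (cong (_∸ n) (Σᶠ≡n+Σᶠ∸1 n m λ i → ≤-trans (ℕ.s≤s ℕ.z≤n) (3≤m i))) (m+n∸m≡n n (degree n m))
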